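{- Let $r\ge 2$ and let $p_1,\dots,p_k$ be positive integers such that $p_i\ge r-1$ for all $i\in\{1,\dots,k\}$ with at most one exception. Then $\chi(K_{p_1,p_2,\ldots,p_k}^r)=k$.
   Context: A coloring of a hypergraph is proper if no edge is monochromatic; $\chi$ is the chromatic number. For positive integers $p_1,\dots,p_k$ and disjoint sets $V_1,\dots,V_k$ with $|V_i|=p_i$, the hypergraph $K^r_{p_1,\dots,p_k}$ has vertex set $V_1\cup\cdots\cup V_k$ and edge set consisting of all $r$-subsets $S$ of the vertex set with $S\not\subseteq V_i$ for every $i$. -}

module Defs where

open import Data.Nat using (ℕ; _<_)
open import Data.Fin using (Fin)
open import Data.Product using (Σ; ∃; _×_; proj₁)
open import Data.List using (List; length)
open import Data.List.Relation.Unary.All using (All)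
open import Data.List.Relation.Unary.Unique.Propositional using (Unique)
open import Relation.Binary.PropositionalEquality using (_≡_)
open import Relation.Nullary using (¬_)

-- A hypergraph on vertex type V is given by a predicate on finite vertex lists:
-- a duplicate-free list S satisfies the predicate iff the set of its elements is an edge.

Monochromatic : {V : Set} {m : ℕ} → (V → Fin m) → List V → Set
Monochromatic {m = m} c S = ∃ λ (a : Fin m) → All (λ v → c v ≡ a) S

IsProperColoring : {V : Set} → (List V → Set) → (m : ℕ) → (V → Fin m) → Set
IsProperColoring Edge m c = ∀ S → Edge S → ¬ Monochromatic c S

Colorable : {V : Set} → (List V → Set) → ℕ → Set
Colorable {V} Edge m = Σ (V → Fin m) (IsProperColoring Edge m)

ChromaticNumberIs : {V : Set} → (List V → Set) → ℕ → Set
ChromaticNumberIs Edge m = Colorable Edge m × (∀ m′ → m′ < m → ¬ Colorable Edge m′)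

-- The complete k-partite r-uniform hypergraph K^r_{p_1,…,p_k}.
-- Vertex set V_1 ∪ … ∪ V_k, realised as pairs (i , x) with x ∈ Fin (p i); part of (i , x) is i.
KVertex : (k : ℕ) → (Fin k → ℕ) → Set
KVertex k p = Σ (Fin k) (λ i → Fin (p i))

KEdge : (r k : ℕ) (p : Fin k → ℕ) → List (KVertex k p) → Set
KEdge r k p S =
  Unique S × length S ≡ r × (∀ (i : Fin k) → ¬ All (λ v → proj₁ v ≡ i) S)

-- Colouring every vertex by its part is proper, since an edge meets two parts. Conversely,
-- suppose the vertices of a set P of parts are coloured from a set C of fewer than |P| colours.
-- As at most one part has fewer than r − 1 vertices, P carries more than (|P| − 1)(r − 1) vertices,
-- so by pigeonhole some colour class has at least r of them. If this class meets two parts, r of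
-- its vertices, two of them in different parts, form a monochromatic edge. Otherwise it lies in a
-- single part, and deleting that part and that colour from P and C preserves the situation with
-- one colour fewer, so the process must end with a monochromatic edge.
module Submission where

open import Defs
open import Data.Nat using (ℕ; zero; suc; _+_; _*_; _≤_; _<_; _∸_; z≤n; s≤s; _<?_; _≤?_)
open import Data.Nat.Properties
  using (+-suc; +-cancelˡ-<; +-mono-≤; +-monoˡ-≤; *-monoˡ-≤; m≤n⇒m⊓n≡m; m≤m+n;
         ≤-reflexive; ≤-trans; ≤-pred; <-≤-trans; ≤-<-trans; ≮⇒≥; ≰⇒>)
open import Data.Nat.Induction using (<-wellFounded)
open import Data.Fin using (Fin; _≟_)
open import Data.Product using (Σ; ∃; _×_; _,_; proj₁)
open import Data.Sum using (_⊎_; inj₁; inj₂)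
open import Data.List using (List; []; _∷_; length; map; filter; take; _++_; allFin)
open import Data.List.Properties
  using (length-map; length-++; length-tabulate; length-take; filter-notAll; filter-all)
open import Data.List.Relation.Unary.All as All using (All; []; _∷_; all?)
open import Data.List.Relation.Unary.All.Properties using (¬All⇒Any¬; all-filter; filter⁺)
open import Data.List.Relation.Unary.Any as Any using (Any; here; there)
open import Data.List.Relation.Unary.AllPairs using (AllPairs; []; _∷_)
open import Data.List.Relation.Unary.Unique.Propositional using (Unique)
import Data.List.Relation.Unary.Unique.Propositional.Properties as Unique
open import Data.List.Relation.Binary.Sublist.Propositional using (_⊆_; []; _∷_; _∷ʳ_)
open import Data.List.Relation.Binary.Sublist.Propositional.Properties
  using (All-resp-⊆; take-⊆; filter-⊆; length-mono-≤)
import Data.List.Relation.Binary.Sublist.Propositional.Properties as Sublist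
open import Data.List.Membership.Propositional using (_∈_)
open import Data.List.Membership.Propositional.Properties
  using (∈-map⁺; ∈-map⁻; ∈-++⁺ˡ; ∈-++⁺ʳ; ∈-++⁻; ∈-filter⁺; ∈-filter⁻; ∈-allFin)
open import Induction.WellFounded using (Acc; acc)
open import Relation.Binary using (Rel)
open import Relation.Binary.Definitions using (DecidableEquality)
open import Relation.Binary.PropositionalEquality
  using (_≡_; _≢_; refl; sym; trans; cong; subst; subst₂; module ≡-Reasoning)
open import Relation.Nullary using (¬_; Dec; yes; no; ¬?; contradiction)
open import Relation.Unary using (Pred; Decidable)
open import Level using (0ℓ)

module _ {A : Set} where

  length-filter-∁ : {P : Pred A 0ℓ} (P? : Decidable P) (xs : List A) →
    length (filter P? xs) + length (filter (λ x → ¬? (P? x)) xs) ≡ length xs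
  length-filter-∁ P? [] = refl
  length-filter-∁ P? (x ∷ xs) with P? x
  ... | yes _ = cong suc (length-filter-∁ P? xs)
  ... | no _ = trans (+-suc _ _) (cong suc (length-filter-∁ P? xs))

  AllPairs-resp-⊆ : {R : Rel A 0ℓ} {xs ys : List A} → xs ⊆ ys → AllPairs R ys → AllPairs R xs
  AllPairs-resp-⊆ [] [] = []
  AllPairs-resp-⊆ (_ ∷ʳ xs⊆ys) (_ ∷ Rys) = AllPairs-resp-⊆ xs⊆ys Rys
  AllPairs-resp-⊆ (refl ∷ xs⊆ys) (Ry ∷ Rys) = All-resp-⊆ xs⊆ys Ry ∷ AllPairs-resp-⊆ xs⊆ys Rys

  ⊆-ofLength-meeting : {Q : Pred A 0ℓ} (n : ℕ) {xs : List A} → suc n ≤ length xs → Any Q xs →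
    ∃ λ ys → ys ⊆ xs × length ys ≡ suc n × Any Q ys
  ⊆-ofLength-meeting n {x ∷ xs} (s≤s n≤|xs|) (here q) =
    x ∷ take n xs , refl ∷ take-⊆ n xs , cong suc (trans (length-take n xs) (m≤n⇒m⊓n≡m n≤|xs|)) , here q
  ⊆-ofLength-meeting zero {x ∷ y ∷ xs} _ (there q) =
    let ys , ys⊆ , |ys| , qys = ⊆-ofLength-meeting zero (s≤s z≤n) q in ys , x ∷ʳ ys⊆ , |ys| , qys
  ⊆-ofLength-meeting (suc n) {x ∷ xs} (s≤s n<|xs|) (there q) =
    let ys , ys⊆ , |ys| , qys = ⊆-ofLength-meeting n n<|xs| q in x ∷ ys , refl ∷ ys⊆ , cong suc |ys| , there qys

module _ {A B : Set} (_≟ᴮ_ : DecidableEquality B) (f : A → B) where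

  fibre : B → List A → List A
  fibre b = filter (λ x → f x ≟ᴮ b)

  pigeonhole : (q : ℕ) (bs : List B) (xs : List A) → All (λ x → f x ∈ bs) xs →
    length bs * q < length xs → ∃ λ b → b ∈ bs × q < length (fibre b xs)
  pigeonhole q [] (x ∷ xs) (() ∷ _) _
  pigeonhole q (b ∷ bs) xs f∈ |xs|>q+|bs|q with q <? length (fibre b xs)
  ... | yes fibre-large = b , here refl , fibre-large
  ... | no fibre-small =
    let b′ , b′∈bs , fibre′-large = pigeonhole q bs rest rest-into-bs |rest|>|bs|q
    in b′ , there b′∈bs , <-≤-trans fibre′-large fibre-of-rest≤fibre
    where
    rest = filter (λ x → ¬? (f x ≟ᴮ b)) xs
    rest-into-bs : All (λ x → f x ∈ bs) rest
    rest-into-bs = All.zipWith (λ (fx∈ , fx≢b) → Any.tail fx≢b fx∈)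
      (filter⁺ _ f∈ , all-filter (λ x → ¬? (f x ≟ᴮ b)) xs)
    |rest|>|bs|q : length bs * q < length rest
    |rest|>|bs|q = +-cancelˡ-< q _ _ (<-≤-trans
      (subst (q + length bs * q <_) (sym (length-filter-∁ (λ x → f x ≟ᴮ b) xs)) |xs|>q+|bs|q)
      (+-monoˡ-≤ (length rest) (≮⇒≥ fibre-small)))
    fibre-of-rest≤fibre : ∀ {b′} → length (fibre b′ rest) ≤ length (fibre b′ xs)
    fibre-of-rest≤fibre = length-mono-≤ (Sublist.filter⁺ _ _ (λ { refl fx≡ → fx≡ }) (filter-⊆ _ xs))

module _ {A : Set} (_≟ᴬ_ : DecidableEquality A) where

  length≤1+length-filter-≢ : (x : A) {xs : List A} → Unique xs →
    length xs ≤ suc (length (filter (λ y → ¬? (y ≟ᴬ x)) xs))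
  length≤1+length-filter-≢ x [] = z≤n
  length≤1+length-filter-≢ x {y ∷ xs} (y∉xs ∷ u) with y ≟ᴬ x
  ... | yes refl = s≤s (≤-reflexive (sym (cong length
          (filter-all (λ z → ¬? (z ≟ᴬ y)) (All.map (λ y≢z z≡y → y≢z (sym z≡y)) y∉xs)))))
  ... | no _ = s≤s (length≤1+length-filter-≢ x u)

module Parts {k : ℕ} (p : Fin k → ℕ) where

  part : KVertex k p → Fin k
  part = proj₁

  part-isProperColoring : (r : ℕ) → IsProperColoring (KEdge r k p) k part
  part-isProperColoring r S (_ , _ , notWithinPart) (i , withinPart) = notWithinPart i withinPart

  meetsTwoParts⇒notWithinPart : {x : KVertex k p} {T : List (KVertex k p)} →
    Any (λ v → part v ≢ part x) T → ∀ i → ¬ All (λ v → part v ≡ i) (x ∷ T)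
  meetsTwoParts⇒notWithinPart otherPart i (x∈i ∷ T∈i) =
    let y∈i , y∉x = All.lookupAny T∈i otherPart in y∉x (trans y∈i (sym x∈i))

  containsEdgeOrWithinPart : (n : ℕ) (S : List (KVertex k p)) → Unique S →
    suc (suc n) ≤ length S →
    (∃ λ T → T ⊆ S × KEdge (suc (suc n)) k p T) ⊎ (∃ λ i → All (λ v → part v ≡ i) S)
  containsEdgeOrWithinPart n (x ∷ S) u (s≤s |S|>n) with all? (λ v → part v ≟ part x) S
  ... | yes sameAsX = inj₂ (part x , refl ∷ sameAsX)
  ... | no ¬sameAsX =
    let T , T⊆S , |T| , otherPart =
          ⊆-ofLength-meeting n |S|>n (¬All⇒Any¬ (λ v → part v ≟ part x) S ¬sameAsX)
    in inj₁ (x ∷ T , refl ∷ T⊆S ,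
             AllPairs-resp-⊆ (refl ∷ T⊆S) u , cong suc |T| , meetsTwoParts⇒notWithinPart otherPart)

  partVertices : Fin k → List (KVertex k p)
  partVertices i = map (i ,_) (allFin (p i))

  verticesIn : List (Fin k) → List (KVertex k p)
  verticesIn [] = []
  verticesIn (i ∷ is) = partVertices i ++ verticesIn is

  ∈-partVertices⁻ : ∀ {v i} → v ∈ partVertices i → part v ≡ i
  ∈-partVertices⁻ v∈ with ∈-map⁻ _ v∈
  ... | _ , _ , refl = refl

  ∈-verticesIn⁻ : ∀ {v} is → v ∈ verticesIn is → part v ∈ is
  ∈-verticesIn⁻ (i ∷ is) v∈ with ∈-++⁻ (partVertices i) v∈
  ... | inj₁ v∈i = here (∈-partVertices⁻ v∈i)
  ... | inj₂ v∈is = there (∈-verticesIn⁻ is v∈is)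

  ∈-verticesIn⁺ : ∀ v is → part v ∈ is → v ∈ verticesIn is
  ∈-verticesIn⁺ (i , x) (i ∷ is) (here refl) = ∈-++⁺ˡ (∈-map⁺ (i ,_) (∈-allFin x))
  ∈-verticesIn⁺ v (i ∷ is) (there v∈is) = ∈-++⁺ʳ (partVertices i) (∈-verticesIn⁺ v is v∈is)

  verticesIn-unique : ∀ is → Unique is → Unique (verticesIn is)
  verticesIn-unique [] [] = []
  verticesIn-unique (i ∷ is) (i∉is ∷ u) =
    Unique.++⁺ (Unique.map⁺ (λ { refl → refl }) (Unique.allFin⁺ (p i))) (verticesIn-unique is u) disjoint
    where
    disjoint : ∀ {v} → ¬ (v ∈ partVertices i × v ∈ verticesIn is)
    disjoint (v∈i , v∈is) =
      All.lookup i∉is (subst (_∈ is) (∈-partVertices⁻ v∈i) (∈-verticesIn⁻ is v∈is)) refl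

  length-verticesIn : ∀ i is → length (verticesIn (i ∷ is)) ≡ p i + length (verticesIn is)
  length-verticesIn i is = begin
    length (partVertices i ++ verticesIn is)          ≡⟨ length-++ (partVertices i) ⟩
    length (partVertices i) + length (verticesIn is)  ≡⟨ cong (_+ length (verticesIn is)) length-partVertices ⟩
    p i + length (verticesIn is)                      ∎
    where
    open ≡-Reasoning
    length-partVertices : length (partVertices i) ≡ p i
    length-partVertices = trans (length-map _ (allFin (p i))) (length-tabulate _)

module _ {k : ℕ} (p : Fin k → ℕ) (q : ℕ) (nonempty : ∀ i → 1 ≤ p i)
         (atMostOneSmall : ∀ i j → p i < q → p j < q → i ≡ j) where

  open Parts p

  allLarge⇒length-verticesIn≥ : ∀ is → All (λ i → q ≤ p i) is →
    length is * q ≤ length (verticesIn is)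
  allLarge⇒length-verticesIn≥ [] [] = z≤n
  allLarge⇒length-verticesIn≥ (i ∷ is) (large ∷ larges) =
    subst (q + length is * q ≤_) (sym (length-verticesIn i is))
      (+-mono-≤ large (allLarge⇒length-verticesIn≥ is larges))

  unique⇒length-verticesIn> : ∀ i is → Unique (i ∷ is) →
    length is * q < length (verticesIn (i ∷ is))
  unique⇒length-verticesIn> i is u =
    subst (length is * q <_) (sym (length-verticesIn i is)) (lowerBound is u (q ≤? p i))
    where
    lowerBound : ∀ is → Unique (i ∷ is) → Dec (q ≤ p i) → length is * q < p i + length (verticesIn is)
    lowerBound [] _ (yes _) = ≤-trans (nonempty i) (m≤m+n (p i) 0)
    lowerBound (j ∷ is) (_ ∷ u) (yes large) =
      subst (_≤ p i + length (verticesIn (j ∷ is))) (+-suc q _)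
        (+-mono-≤ large (unique⇒length-verticesIn> j is u))
    lowerBound is (i∉is ∷ _) (no small) =
      +-mono-≤ (nonempty i) (allLarge⇒length-verticesIn≥ is (All.map othersLarge i∉is))
      where
      othersLarge : ∀ {j} → i ≢ j → q ≤ p j
      othersLarge {j} i≢j with q ≤? p j
      ... | yes large = large
      ... | no small′ = contradiction (atMostOneSmall i j (≰⇒> small) (≰⇒> small′)) i≢j

module Colouring {k : ℕ} (p : Fin k → ℕ) (n : ℕ) (nonempty : ∀ i → 1 ≤ p i)
                 (atMostOneSmall : ∀ i j → p i < suc n → p j < suc n → i ≡ j)
                 {m : ℕ} (c : KVertex k p → Fin m) where

  open Parts p

  MonochromaticEdge : Set
  MonochromaticEdge = ∃ λ T → KEdge (suc (suc n)) k p T × Monochromatic c T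

  record Cover : Set where
    field
      parts : List (Fin k)
      colours : List (Fin m)
      parts-unique : Unique parts
      fewerColours : length colours < length parts
      covers : ∀ v → part v ∈ parts → c v ∈ colours
  open Cover

  allPartsCover : m < k → Cover
  allPartsCover m<k = record
    { parts = allFin k
    ; colours = allFin m
    ; parts-unique = Unique.allFin⁺ k
    ; fewerColours = subst₂ _<_ (sym (length-tabulate _)) (sym (length-tabulate _)) m<k
    ; covers = λ v _ → ∈-allFin (c v)
    }

  colourClass : Fin m → List (Fin k) → List (KVertex k p)
  colourClass a is = fibre _≟_ c a (verticesIn is)

  dropColourClass : (C : Cover) {a : Fin m} → a ∈ colours C → (i₀ : Fin k) →
    All (λ v → part v ≡ i₀) (colourClass a (parts C)) →
    Σ Cover λ C′ → length (colours C′) < length (colours C)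
  dropColourClass C {a} a∈cs i₀ classWithin = cover′ , fewerThanBefore
    where
    is′ = filter (λ i → ¬? (i ≟ i₀)) (parts C)
    cs′ = filter (λ b → ¬? (b ≟ a)) (colours C)
    fewerThanBefore : length cs′ < length (colours C)
    fewerThanBefore = filter-notAll _ (colours C) (Any.map (λ a≡b b≢a → b≢a (sym a≡b)) a∈cs)
    covers′ : ∀ v → part v ∈ is′ → c v ∈ cs′
    covers′ v v∈is′ =
      let v∈is , v∉i₀ = ∈-filter⁻ _ v∈is′
      in ∈-filter⁺ _ (covers C v v∈is)
           (λ cv≡a → v∉i₀ (All.lookup classWithin (∈-filter⁺ _ (∈-verticesIn⁺ v _ v∈is) cv≡a)))
    cover′ : Cover
    cover′ = record
      { parts = is′
      ; colours = cs′
      ; parts-unique = Unique.filter⁺ _ (parts-unique C)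
      ; fewerColours = ≤-pred (≤-trans (s≤s fewerThanBefore)
          (≤-trans (fewerColours C) (length≤1+length-filter-≢ _≟_ i₀ (parts-unique C))))
      ; covers = covers′
      }

  length-colours*[1+n]<length-verticesIn : (C : Cover) →
    length (colours C) * suc n < length (verticesIn (parts C))
  length-colours*[1+n]<length-verticesIn C with parts C | parts-unique C | fewerColours C
  ... | i ∷ is | u | s≤s |cs|≤|is| =
    ≤-<-trans (*-monoˡ-≤ (suc n) |cs|≤|is|)
      (unique⇒length-verticesIn> p (suc n) nonempty atMostOneSmall i is u)

  cover-step : (C : Cover) → MonochromaticEdge ⊎ (Σ Cover λ C′ → length (colours C′) < length (colours C))
  cover-step C
    with pigeonhole _≟_ c (suc n) (colours C) (verticesIn (parts C))
           (All.tabulate (λ v∈ → covers C _ (∈-verticesIn⁻ _ v∈))) (length-colours*[1+n]<length-verticesIn C)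
  ... | a , a∈cs , classLarge
    with containsEdgeOrWithinPart n (colourClass a (parts C))
           (Unique.filter⁺ _ (verticesIn-unique _ (parts-unique C))) classLarge
  ... | inj₁ (T , T⊆class , edge) =
    inj₁ (T , edge , a , All-resp-⊆ T⊆class (all-filter (λ v → c v ≟ a) (verticesIn (parts C))))
  ... | inj₂ (i₀ , classWithin) = inj₂ (dropColourClass C a∈cs i₀ classWithin)

  monochromaticEdge : (C : Cover) → Acc _<_ (length (colours C)) → MonochromaticEdge
  monochromaticEdge C (acc smaller) with cover-step C
  ... | inj₁ edge = edge
  ... | inj₂ (C′ , fewer) = monochromaticEdge C′ (smaller fewer)

proposition2p8 : (r k : ℕ) (p : Fin k → ℕ) → 2 ≤ r
    → (∀ i → 1 ≤ p i)
    → (∀ i j → p i < r ∸ 1 → p j < r ∸ 1 → i ≡ j)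
    → ChromaticNumberIs (KEdge r k p) k
proposition2p8 (suc (suc n)) k p (s≤s (s≤s z≤n)) nonempty atMostOneSmall =
  (Parts.part p , Parts.part-isProperColoring p (suc (suc n))) ,
  λ m m<k (c , proper) →
    let open Colouring p n nonempty atMostOneSmall c
        T , edge , monochromatic = monochromaticEdge (allPartsCover m<k) (<-wellFounded _)
    in proper T edge monochromatic
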